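{- Let $n$ be a positive integer. For any function $f:(\{0,1\}^n)^3\to\{0,1\}$ there exists a uniform $(2,3)$-SHELA source $\mathbf{X}$ over $(\{0,1\}^n)^3$ such that the statistical distance between $f(\mathbf{X})$ and the uniform distribution $\mathbf{U}_1$ on $\{0,1\}$ is at least $0.08$.
   Context: A uniform $(g,\ell)$-SHELA source over $(\{0,1\}^n)^\ell$ is a random variable $\mathbf{X}=(\mathbf{X}_1,\dots,\mathbf{X}_\ell)$, each $\mathbf{X}_i$ taking values in $\{0,1\}^n$, for which there is a set $G\subseteq[\ell]$ of at least $g$ indices ("good blocks") such that the blocks $\mathbf{X}_i$, $i\in G$, are mutually independent and each uniformly distributed on $\{0,1\}^n$, while every other block $\mathbf{X}_j$, $j\notin G$, is an arbitrary function of the preceding blocks $\mathbf{X}_1,\dots,\mathbf{X}_{j-1}$ only. -}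

module Defs where

open import Data.Bool using (Bool; true; false)
open import Data.Nat as ℕ using (ℕ; zero; suc; _^_)
open import Data.Nat.Properties using (m^n≢0)
open import Data.Fin using (Fin; inject₁; fromℕ)
open import Data.Vec using (Vec; []; _∷_; _∷ʳ_; lookup)
open import Data.List using (List; []; _∷_; map; concatMap; filter; length)
open import Data.Integer using (+_)
open import Data.Rational using (ℚ; _/_; _+_; _-_; ∣_∣; ½; _*_)
open import Relation.Binary.PropositionalEquality using (_≡_)
open import Data.Bool.Properties using (_≟_)

Block : ℕ → Set
Block n = Vec Bool n

-- Description of a uniform SHELA-type source over ({0,1}^n)^ℓ, built block by
-- block from left to right.  A `good` step appends a fresh block that is
-- uniform and independent of everything before; a `bad` step appends a block
-- that is an arbitrary (deterministic) function of the preceding blocks.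
data Spec (n : ℕ) : ℕ → Set where
  []   : Spec n 0
  good : ∀ {ℓ} → Spec n ℓ → Spec n (suc ℓ)
  bad  : ∀ {ℓ} → Spec n ℓ → (Vec (Block n) ℓ → Block n) → Spec n (suc ℓ)

goodCount : ∀ {n ℓ} → Spec n ℓ → ℕ
goodCount []        = 0
goodCount (good S)  = suc (goodCount S)
goodCount (bad S h) = goodCount S

-- The source as a function of independent uniform seeds s : Fin ℓ → {0,1}^n:
-- block i equals seed i if i is good, and h(X_1..X_{i-1}) otherwise.
sample : ∀ {n ℓ} → Spec n ℓ → (Fin ℓ → Block n) → Vec (Block n) ℓ
sample []        s = []
sample (good S)  s = sample S (λ i → s (inject₁ i)) ∷ʳ s (fromℕ _)
sample (bad S h) s = let p = sample S (λ i → s (inject₁ i)) in p ∷ʳ h p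

IsUniformSHELA : ∀ {n ℓ} → ℕ → Spec n ℓ → Set
IsUniformSHELA g S = g ℕ.≤ goodCount S

allBlocks : (n : ℕ) → List (Block n)
allBlocks zero    = [] ∷ []
allBlocks (suc n) = concatMap (λ v → (false ∷ v) ∷ (true ∷ v) ∷ []) (allBlocks n)

allVecs : ∀ {A : Set} → List A → (ℓ : ℕ) → List (Vec A ℓ)
allVecs xs zero    = [] ∷ []
allVecs xs (suc ℓ) = concatMap (λ x → map (x ∷_) (allVecs xs ℓ)) xs

prob : ∀ {n ℓ} → (Vec (Block n) ℓ → Bool) → Spec n ℓ → Bool → ℚ
prob {n} {ℓ} f S b =
  _/_ (+ length (filter (λ s → f (sample S (lookup s)) ≟ b) (allVecs (allBlocks n) ℓ)))
      (2 ^ (n ℕ.* ℓ)) {{m^n≢0 2 (n ℕ.* ℓ)}}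

BitDist : Set
BitDist = Bool → ℚ

U₁ : BitDist
U₁ _ = ½

SD : BitDist → BitDist → ℚ
SD P Q = ½ * (∣ P false - Q false ∣ + ∣ P true - Q true ∣)

module Submission where

-- Four sources with two uniform blocks each are tried: S₁ = (X, Y, h₁(X,Y)) and S₀ = (X, Y, h₀(X,Y)),
-- where h_b picks a third block making f equal to b whenever one exists; S₂ = (X, h₂(X), Z), where
-- h₂ picks a y with f(X, y, ·) ≡ 1 whenever one exists; and S₃ c = (c, Y, Z) for a constant c.
-- Suppose each has Pr[f = 1] strictly between 0.42 and 0.58.  For an x without an all-ones row every
-- row contains a zero, so S₀ loses that row entirely while S₁ gains it: Pr₁ ≥ Pr₀ + E[R(X); X has no
-- all-ones row], with R(x) = Pr[f(x, Y, Z) = 1] > 0.42 by S₃ x.  Since S₂ bounds the mass of the x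
-- having an all-ones row by 0.58, Pr₁ > 0.42 + 0.42 · 0.42 > 0.58, a contradiction.

open import Defs
open import Data.Bool using (Bool; true; false; not; T)
open import Data.Bool.Properties as Bool using ()
open import Data.Nat hiding (_/_)
open import Data.Nat.Properties
open import Data.Nat.Tactic.RingSolver using (solve-∀)
open import Algebra.Properties.CommutativeSemigroup +-commutativeSemigroup
  using () renaming (interchange to +-interchange)
open import Data.List using (List; []; _∷_; map; concatMap; filter; length; _++_)
open import Data.List.Properties using (length-++; length-map)
open import Data.List.Membership.Propositional using (_∈_; lose)
open import Data.List.Relation.Unary.Any using (here; there; any?; satisfied)
open import Data.Vec using (Vec; []; _∷_; lookup; replicate)
open import Data.Fin using (zero; suc)
open import Data.Product using (Σ; _×_; _,_; proj₁; proj₂)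
open import Data.Sum using (_⊎_; inj₁; inj₂)
open import Data.Empty using (⊥; ⊥-elim)
open import Function using (_∘_)
open import Relation.Nullary using (Dec; yes; no; ¬_; does; contradiction)
open import Relation.Nullary.Decidable using (_⊎-dec_)
open import Relation.Unary using (Pred; Decidable)
open import Relation.Binary.PropositionalEquality
open import Data.Integer as ℤ using (+_; -[1+_])
import Data.Integer.Properties as ℤ
open import Data.Rational as ℚ using (mkℚ; _/_; ½) renaming (_≤_ to _≤ℚ_)
import Data.Rational.Properties as ℚ
import Data.Rational.Unnormalised as ℚᵘ
import Data.Rational.Unnormalised.Properties as ℚᵘ

𝟙 : Bool → ℕ
𝟙 true  = 1
𝟙 false = 0

𝟙≤1 : ∀ b → 𝟙 b ≤ 1
𝟙≤1 true  = ≤-refl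
𝟙≤1 false = z≤n

𝟙-not : ∀ b → 𝟙 b + 𝟙 (not b) ≡ 1
𝟙-not true  = refl
𝟙-not false = refl

𝟙-≢true : ∀ {b} → b ≢ true → 𝟙 b ≤ 0
𝟙-≢true {true}  b≢true = contradiction refl b≢true
𝟙-≢true {false} _      = z≤n

𝟙-≢false : ∀ {b} → b ≢ false → 1 ≤ 𝟙 b
𝟙-≢false {true}  _       = ≤-refl
𝟙-≢false {false} b≢false = contradiction refl b≢false

does-≟-true : ∀ b → does (b Bool.≟ true) ≡ b
does-≟-true true  = refl
does-≟-true false = refl

does-≟-complement : ∀ b → 𝟙 (does (b Bool.≟ false)) + 𝟙 (does (b Bool.≟ true)) ≡ 1
does-≟-complement true  = refl
does-≟-complement false = refl

∑ : {A : Set} → List A → (A → ℕ) → ℕ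
∑ []       g = 0
∑ (x ∷ xs) g = g x + ∑ xs g

infix 5 ∑
syntax ∑ xs (λ x → e) = ∑[ x ∈ xs ] e

module _ {A : Set} where

  ∑-cong : ∀ xs {g h : A → ℕ} → (∀ x → g x ≡ h x) → ∑ xs g ≡ ∑ xs h
  ∑-cong []       g≡h = refl
  ∑-cong (x ∷ xs) g≡h = cong₂ _+_ (g≡h x) (∑-cong xs g≡h)

  ∑-mono : ∀ xs {g h : A → ℕ} → (∀ x → x ∈ xs → g x ≤ h x) → ∑ xs g ≤ ∑ xs h
  ∑-mono []       g≤h = z≤n
  ∑-mono (x ∷ xs) g≤h = +-mono-≤ (g≤h x (here refl)) (∑-mono xs (λ y y∈xs → g≤h y (there y∈xs)))

  ∑-+ : ∀ xs (g h : A → ℕ) → ∑[ x ∈ xs ] (g x + h x) ≡ ∑ xs g + ∑ xs h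
  ∑-+ []       g h = refl
  ∑-+ (x ∷ xs) g h rewrite ∑-+ xs g h = +-interchange (g x) (h x) (∑ xs g) (∑ xs h)

  ∑-const : ∀ (xs : List A) k → ∑[ x ∈ xs ] k ≡ length xs * k
  ∑-const []       k = refl
  ∑-const (x ∷ xs) k = cong (_+_ k) (∑-const xs k)

  ∑-*ˡ : ∀ xs k (g : A → ℕ) → ∑[ x ∈ xs ] (k * g x) ≡ k * ∑ xs g
  ∑-*ˡ []       k g = sym (*-zeroʳ k)
  ∑-*ˡ (x ∷ xs) k g rewrite ∑-*ˡ xs k g = sym (*-distribˡ-+ k (g x) (∑ xs g))

  ∑-++ : ∀ xs ys (g : A → ℕ) → ∑ (xs ++ ys) g ≡ ∑ xs g + ∑ ys g
  ∑-++ []       ys g = refl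
  ∑-++ (x ∷ xs) ys g rewrite ∑-++ xs ys g = sym (+-assoc (g x) _ _)

  ∑-map : ∀ {B : Set} (k : B → A) xs (g : A → ℕ) → ∑ (map k xs) g ≡ ∑[ x ∈ xs ] g (k x)
  ∑-map k []       g = refl
  ∑-map k (x ∷ xs) g = cong (_+_ (g (k x))) (∑-map k xs g)

  ∑-concatMap : ∀ {B : Set} (k : B → List A) xs (g : A → ℕ) →
                ∑ (concatMap k xs) g ≡ ∑[ x ∈ xs ] ∑ (k x) g
  ∑-concatMap k []       g = refl
  ∑-concatMap k (x ∷ xs) g =
    trans (∑-++ (k x) (concatMap k xs) g) (cong (_+_ (∑ (k x) g)) (∑-concatMap k xs g))

  length-filter-∑ : ∀ {p} {P : Pred A p} (P? : Decidable P) xs →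
                    length (filter P? xs) ≡ ∑[ x ∈ xs ] 𝟙 (does (P? x))
  length-filter-∑ P? []       = refl
  length-filter-∑ P? (x ∷ xs) with does (P? x)
  ... | true  = cong suc (length-filter-∑ P? xs)
  ... | false = length-filter-∑ P? xs

  length-concatMap : ∀ {B : Set} (k : B → List A) xs →
                     length (concatMap k xs) ≡ ∑[ x ∈ xs ] length (k x)
  length-concatMap k []       = refl
  length-concatMap k (x ∷ xs) =
    trans (length-++ (k x)) (cong (_+_ (length (k x))) (length-concatMap k xs))

module _ {A : Set} {p} {P : Pred A p} (P? : Decidable P) (default : A) where

  choose : List A → A
  choose []       = default
  choose (x ∷ xs) with P? x
  ... | yes _ = x
  ... | no  _ = choose xs

  choose-spec : ∀ xs → P (choose xs) ⊎ (∀ x → x ∈ xs → ¬ P x)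
  choose-spec []       = inj₂ (λ _ ())
  choose-spec (x ∷ xs) with P? x
  ... | yes px = inj₁ px
  ... | no ¬px with choose-spec xs
  ...   | inj₁ pc   = inj₁ pc
  ...   | inj₂ none = inj₂ λ { y (here refl) → ¬px ; y (there y∈xs) → none y y∈xs }

count : {A : Set} → List A → (A → Bool) → ℕ
count xs g = ∑[ x ∈ xs ] 𝟙 (g x)

module _ {A : Set} (xs : List A) (g : A → Bool) where

  count≤length : count xs g ≤ length xs
  count≤length = begin
    count xs g           ≤⟨ ∑-mono xs (λ x _ → 𝟙≤1 (g x)) ⟩
    ∑[ x ∈ xs ] 1        ≡⟨ ∑-const xs 1 ⟩
    length xs * 1        ≡⟨ *-identityʳ (length xs) ⟩
    length xs            ∎
    where open ≤-Reasoning

  module _ (default : A) where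

    chooseTrue chooseFalse : A
    chooseTrue  = choose (λ x → g x Bool.≟ true)  default xs
    chooseFalse = choose (λ x → g x Bool.≟ false) default xs

    count≤length*chooseTrue : count xs g ≤ length xs * 𝟙 (g chooseTrue)
    count≤length*chooseTrue with choose-spec (λ x → g x Bool.≟ true) default xs
    ... | inj₁ g≡true rewrite g≡true = subst (count xs g ≤_) (sym (*-identityʳ _)) count≤length
    ... | inj₂ none = begin
      count xs g      ≤⟨ ∑-mono xs (λ x x∈xs → 𝟙-≢true (none x x∈xs)) ⟩
      ∑[ x ∈ xs ] 0   ≡⟨ ∑-const xs 0 ⟩
      length xs * 0   ≤⟨ *-monoʳ-≤ (length xs) z≤n ⟩
      length xs * _   ∎
      where open ≤-Reasoning

    length*chooseFalse≤count : length xs * 𝟙 (g chooseFalse) ≤ count xs g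
    length*chooseFalse≤count with choose-spec (λ x → g x Bool.≟ false) default xs
    ... | inj₁ g≡false rewrite g≡false | *-zeroʳ (length xs) = z≤n
    ... | inj₂ none = begin
      length xs * _   ≤⟨ *-monoʳ-≤ (length xs) (𝟙≤1 (g chooseFalse)) ⟩
      length xs * 1   ≡⟨ ∑-const xs 1 ⟨
      ∑[ x ∈ xs ] 1   ≤⟨ ∑-mono xs (λ x x∈xs → 𝟙-≢false (none x x∈xs)) ⟩
      count xs g      ∎
      where open ≤-Reasoning

    count<length⇒chooseFalse : count xs g < length xs → g chooseFalse ≡ false
    count<length⇒chooseFalse count<N with g chooseFalse | length*chooseFalse≤count
    ... | false | _        = refl
    ... | true  | N*1≤count = contradiction (≤-trans (≤-reflexive (sym (*-identityʳ _))) N*1≤count)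
                                            (<⇒≱ count<N)

length-allBlocks : ∀ n → length (allBlocks n) ≡ 2 ^ n
length-allBlocks zero    = refl
length-allBlocks (suc n) = begin
  length (allBlocks (suc n))   ≡⟨ length-concatMap _ (allBlocks n) ⟩
  ∑[ v ∈ allBlocks n ] 2       ≡⟨ ∑-const (allBlocks n) 2 ⟩
  length (allBlocks n) * 2     ≡⟨ *-comm (length (allBlocks n)) 2 ⟩
  2 * length (allBlocks n)     ≡⟨ cong (2 *_) (length-allBlocks n) ⟩
  2 ^ suc n                    ∎
  where open ≡-Reasoning

module _ {A : Set} (xs : List A) where

  ∑-allVecs-suc : ∀ ℓ (g : Vec A (suc ℓ) → ℕ) →
                  ∑ (allVecs xs (suc ℓ)) g ≡ ∑[ x ∈ xs ] ∑[ v ∈ allVecs xs ℓ ] g (x ∷ v)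
  ∑-allVecs-suc ℓ g = trans (∑-concatMap _ xs g) (∑-cong xs λ x → ∑-map (x ∷_) (allVecs xs ℓ) g)

  length-allVecs : ∀ ℓ → length (allVecs xs ℓ) ≡ length xs ^ ℓ
  length-allVecs zero    = refl
  length-allVecs (suc ℓ) = begin
    length (allVecs xs (suc ℓ))                       ≡⟨ length-concatMap _ xs ⟩
    ∑[ x ∈ xs ] length (map (x ∷_) (allVecs xs ℓ))    ≡⟨ ∑-cong xs (λ x → length-map (x ∷_) (allVecs xs ℓ)) ⟩
    ∑[ x ∈ xs ] length (allVecs xs ℓ)                 ≡⟨ ∑-const xs _ ⟩
    length xs * length (allVecs xs ℓ)                 ≡⟨ cong (length xs *_) (length-allVecs ℓ) ⟩
    length xs ^ suc ℓ                                 ∎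
    where open ≡-Reasoning

  ∑-allVecs³ : (g : Vec A 3 → ℕ) →
               ∑ (allVecs xs 3) g ≡ ∑[ x ∈ xs ] ∑[ y ∈ xs ] ∑[ z ∈ xs ] g (x ∷ y ∷ z ∷ [])
  ∑-allVecs³ g =
    trans (∑-allVecs-suc 2 g) (∑-cong xs λ x →
    trans (∑-allVecs-suc 1 _) (∑-cong xs λ y →
    trans (∑-allVecs-suc 0 _) (∑-cong xs λ z → +-identityʳ _)))

Far : ℕ → ℕ → Set
Far M c = 58 * M ≤ c * 100 ⊎ c * 100 ≤ 42 * M

far? : ∀ M c → Dec (Far M c)
far? M c = (58 * M ≤? c * 100) ⊎-dec (c * 100 ≤? 42 * M)

¬far⇒balanced : ∀ M c → ¬ Far M c → 42 * M < c * 100 × c * 100 < 58 * M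
¬far⇒balanced M c ¬far = ≰⇒> (¬far ∘ inj₂) , ≰⇒> (¬far ∘ inj₁)

far-complement : ∀ {M} c₀ c₁ → c₀ + c₁ ≡ M → Far M c₁ → Far M c₀
far-complement {M} c₀ c₁ c₀+c₁≡M = λ
  { (inj₁ hi) → inj₂ (+-cancelʳ-≤ (58 * M) (c₀ * 100) (42 * M)
                  (≤-trans (+-monoʳ-≤ (c₀ * 100) hi) (≤-reflexive total)))
  ; (inj₂ lo) → inj₁ (+-cancelʳ-≤ (c₁ * 100) (58 * M) (c₀ * 100)
                  (≤-trans (+-monoʳ-≤ (58 * M) lo)
                           (≤-reflexive (trans (+-comm (58 * M) (42 * M)) (sym total)))))
  }
  where
  total : c₀ * 100 + c₁ * 100 ≡ 42 * M + 58 * M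
  total = begin
    c₀ * 100 + c₁ * 100   ≡⟨ *-distribʳ-+ 100 c₀ c₁ ⟨
    (c₀ + c₁) * 100       ≡⟨ cong (_* 100) c₀+c₁≡M ⟩
    M * 100               ≡⟨ *-comm M 100 ⟩
    100 * M               ≡⟨ *-distribʳ-+ M 42 58 ⟩
    42 * M + 58 * M       ∎
    where open ≡-Reasoning

p≤∣p∣ : ∀ p → p ≤ℚ ℚ.∣ p ∣
p≤∣p∣ (mkℚ (+ _)    _ _) = ℚ.≤-refl
p≤∣p∣ (mkℚ -[1+ _ ] _ _) = ℚ.*≤* ℤ.-≤+

+a/b≤+c/d : ∀ a b c d .{{_ : NonZero b}} .{{_ : NonZero d}} →
            a * d ≤ c * b → (+ a) / b ≤ℚ (+ c) / d
+a/b≤+c/d a (suc b) c (suc d) ad≤cb = ℚ.toℚᵘ-cancel-≤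
  (ℚᵘ.≤-respˡ-≃ (ℚᵘ.≃-sym (ℚ.toℚᵘ-fromℚᵘ (ℚᵘ.mkℚᵘ (+ a) b)))
  (ℚᵘ.≤-respʳ-≃ (ℚᵘ.≃-sym (ℚ.toℚᵘ-fromℚᵘ (ℚᵘ.mkℚᵘ (+ c) d)))
  (ℚᵘ.*≤* (subst₂ ℤ._≤_ (ℤ.pos-* a (suc d)) (ℤ.pos-* c (suc b)) (ℤ.+≤+ ad≤cb)))))

-- The constants close up by computation: 58/100 − ½, ½ − 42/100 and ½ (8/100 + 8/100) all normalise to 8/100.
far⇒8%≤∣-½∣ : ∀ {M} c .{{_ : NonZero M}} → Far M c → (+ 8) / 100 ≤ℚ ℚ.∣ (+ c) / M ℚ.- ½ ∣
far⇒8%≤∣-½∣ {M} c (inj₁ hi) =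
  ℚ.≤-trans (ℚ.+-monoˡ-≤ (ℚ.- ½) (+a/b≤+c/d 58 100 c M hi)) (p≤∣p∣ _)
far⇒8%≤∣-½∣ {M} c (inj₂ lo) =
  ℚ.≤-trans (ℚ.neg-antimono-≤ (ℚ.+-monoˡ-≤ (ℚ.- ½) (+a/b≤+c/d c M 42 100 lo)))
            (subst (ℚ.- ((+ c) / M ℚ.- ½) ≤ℚ_) (ℚ.∣-p∣≡∣p∣ _) (p≤∣p∣ _))

far⇒8%≤SD : ∀ {M} .{{_ : NonZero M}} (c : Bool → ℕ) → c false + c true ≡ M → Far M (c true) →
            (+ 8) / 100 ≤ℚ SD (λ b → (+ c b) / M) U₁
far⇒8%≤SD c total far = ℚ.*-monoˡ-≤-nonNeg ½
  (ℚ.+-mono-≤ (far⇒8%≤∣-½∣ (c false) (far-complement (c false) (c true) total far))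
              (far⇒8%≤∣-½∣ (c true) far))

-- Scaled by 100², the hypotheses give 100²(Q + T) > 4200 M + 42 (100 u) ≥ 4200 M + 42 · 42 M,
-- which exceeds 5800 M > 100² P.
balanced-counts-inconsistent : ∀ M P Q T u v →
  P * 100 < 58 * M → 42 * M < Q * 100 → Q + T ≤ P →
  v * 100 < 58 * M → u + v ≡ M → 42 * u ≤ T * 100 → ⊥
balanced-counts-inconsistent _ P Q T u v P<58% 42%<Q Q+T≤P v<58% refl 42%u≤T =
  <⇒≱ (≤-<-trans (m≤m+n (8236 * M) (164 * M)) (m<m+n _ z<s)) (begin
    8236 * M + 164 * M + 200                               ≡⟨ expand u v ⟩
    (1 + 42 * M) * 100 + (42 * u * 100 + 42 * (v * 100)) + 100
      ≤⟨ +-monoˡ-≤ 100 (+-mono-≤ (*-monoˡ-≤ 100 42%<Q)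
           (+-mono-≤ (*-monoˡ-≤ 100 42%u≤T) (*-monoʳ-≤ 42 (<⇒≤ v<58%)))) ⟩
    Q * 100 * 100 + (T * 100 * 100 + 42 * (58 * M)) + 100  ≡⟨ regroup Q T M ⟩
    (Q + T) * 100 * 100 + 100 + 2436 * M
      ≤⟨ +-monoˡ-≤ (2436 * M) (+-monoˡ-≤ 100 (*-monoˡ-≤ 100 (*-monoˡ-≤ 100 Q+T≤P))) ⟩
    P * 100 * 100 + 100 + 2436 * M
      ≤⟨ +-monoˡ-≤ (2436 * M)
           (subst (_≤ 58 * M * 100) (+-comm 100 (P * 100 * 100)) (*-monoˡ-≤ 100 P<58%)) ⟩
    58 * M * 100 + 2436 * M                                ≡⟨ collect M ⟩
    8236 * M                                               ∎)
  where
  open ≤-Reasoning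
  M = u + v
  expand : ∀ u v → 8236 * (u + v) + 164 * (u + v) + 200 ≡
                   (1 + 42 * (u + v)) * 100 + (42 * u * 100 + 42 * (v * 100)) + 100
  expand = solve-∀
  regroup : ∀ Q T M → Q * 100 * 100 + (T * 100 * 100 + 42 * (58 * M)) + 100 ≡
                      (Q + T) * 100 * 100 + 100 + 2436 * M
  regroup = solve-∀
  collect : ∀ M → 58 * M * 100 + 2436 * M ≡ 8236 * M
  collect = solve-∀

module Construction (n : ℕ) (f : Vec (Block n) 3 → Bool) where

  blocks : List (Block n)
  blocks = allBlocks n

  N M : ℕ
  N = length blocks
  M = 2 ^ (n * 3)

  N^3≡N³ : N ^ 3 ≡ N * (N * N)
  N^3≡N³ = cong (λ t → N * (N * t)) (*-identityʳ N)

  M≡N³ : M ≡ N * (N * N)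
  M≡N³ = begin
    2 ^ (n * 3)    ≡⟨ ^-*-assoc 2 n 3 ⟨
    (2 ^ n) ^ 3    ≡⟨ cong (_^ 3) (length-allBlocks n) ⟨
    N ^ 3          ≡⟨ N^3≡N³ ⟩
    N * (N * N)    ∎
    where open ≡-Reasoning

  F : Block n → Block n → Block n → Bool
  F x y z = f (x ∷ y ∷ z ∷ [])

  hits : Spec n 3 → Bool → ℕ
  hits S b = length (filter (λ s → f (sample S (lookup s)) Bool.≟ b) (allVecs blocks 3))

  hits-true : ∀ S → hits S true ≡
              ∑[ x ∈ blocks ] ∑[ y ∈ blocks ] ∑[ z ∈ blocks ] 𝟙 (f (sample S (lookup (x ∷ y ∷ z ∷ []))))
  hits-true S = trans (length-filter-∑ _ (allVecs blocks 3)) (trans (∑-allVecs³ blocks _)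
    (∑-cong blocks λ x → ∑-cong blocks λ y → ∑-cong blocks λ z → cong 𝟙 (does-≟-true _)))

  hits-false+true : ∀ S → hits S false + hits S true ≡ M
  hits-false+true S = begin
    hits S false + hits S true
      ≡⟨ cong₂ _+_ (length-filter-∑ _ (allVecs blocks 3)) (length-filter-∑ _ (allVecs blocks 3)) ⟩
    ∑ (allVecs blocks 3) _ + ∑ (allVecs blocks 3) _
      ≡⟨ ∑-+ (allVecs blocks 3) _ _ ⟨
    ∑[ s ∈ allVecs blocks 3 ] (𝟙 (does (X s Bool.≟ false)) + 𝟙 (does (X s Bool.≟ true)))
      ≡⟨ ∑-cong (allVecs blocks 3) (λ s → does-≟-complement (X s)) ⟩
    ∑[ s ∈ allVecs blocks 3 ] 1
      ≡⟨ ∑-const (allVecs blocks 3) 1 ⟩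
    length (allVecs blocks 3) * 1
      ≡⟨ *-identityʳ _ ⟩
    length (allVecs blocks 3)
      ≡⟨ length-allVecs blocks 3 ⟩
    N ^ 3
      ≡⟨ N^3≡N³ ⟩
    N * (N * N)
      ≡⟨ M≡N³ ⟨
    M ∎
    where
    open ≡-Reasoning
    X : Vec (Block n) 3 → Bool
    X s = f (sample S (lookup s))

  default : Block n
  default = replicate n false

  ones : Block n → Block n → ℕ
  ones x y = count blocks (F x y)

  z₁ z₀ : Block n → Block n → Block n
  z₁ x y = chooseTrue  blocks (F x y) default
  z₀ x y = chooseFalse blocks (F x y) default

  yFull : Block n → Block n
  yFull x = choose (λ y → ones x y ≟ N) default blocks

  S₁ S₀ S₂ : Spec n 3
  S₁ = bad (good (good [])) (λ v → z₁ (lookup v zero) (lookup v (suc zero)))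
  S₀ = bad (good (good [])) (λ v → z₀ (lookup v zero) (lookup v (suc zero)))
  S₂ = good (bad (good []) (λ v → yFull (lookup v zero)))

  S₃ : Block n → Spec n 3
  S₃ c = good (good (bad [] (λ _ → c)))

  P Q R : Block n → ℕ
  P x = ∑[ y ∈ blocks ] N * 𝟙 (F x y (z₁ x y))
  Q x = ∑[ y ∈ blocks ] N * 𝟙 (F x y (z₀ x y))
  R x = ∑[ y ∈ blocks ] ones x y

  hits-S₁ : hits S₁ true ≡ ∑ blocks P
  hits-S₁ = trans (hits-true S₁) (∑-cong blocks λ x → ∑-cong blocks λ y → ∑-const blocks _)

  hits-S₀ : hits S₀ true ≡ ∑ blocks Q
  hits-S₀ = trans (hits-true S₀) (∑-cong blocks λ x → ∑-cong blocks λ y → ∑-const blocks _)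

  hits-S₂ : hits S₂ true ≡ ∑[ x ∈ blocks ] N * ones x (yFull x)
  hits-S₂ = trans (hits-true S₂) (∑-cong blocks λ x → ∑-const blocks _)

  hits-S₃ : ∀ c → hits (S₃ c) true ≡ N * R c
  hits-S₃ c = trans (hits-true (S₃ c)) (∑-const blocks _)

  -- yFull x is an all-ones row of x whenever there is one, so full x says that there is one.
  full : Block n → Bool
  full x = ones x (yFull x) ≡ᵇ N

  N*full≤ones : ∀ x → N * 𝟙 (full x) ≤ ones x (yFull x)
  N*full≤ones x with full x in eq
  ... | true  = ≤-reflexive (trans (*-identityʳ N) (sym (≡ᵇ⇒≡ _ N (subst T (sym eq) _))))
  ... | false = subst (_≤ ones x (yFull x)) (sym (*-zeroʳ N)) z≤n

  ¬full⇒ones<N : ∀ x → full x ≡ false → ∀ y → y ∈ blocks → ones x y < N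
  ¬full⇒ones<N x ¬full y y∈blocks with choose-spec (λ y → ones x y ≟ N) default blocks
  ... | inj₁ ones≡N = ⊥-elim (subst T ¬full (≡⇒≡ᵇ _ N ones≡N))
  ... | inj₂ none   = ≤∧≢⇒< (count≤length blocks (F x y)) (none y y∈blocks)

  ones-between : ∀ x y → N * 𝟙 (F x y (z₀ x y)) ≤ ones x y × ones x y ≤ N * 𝟙 (F x y (z₁ x y))
  ones-between x y =
    length*chooseFalse≤count blocks (F x y) default , count≤length*chooseTrue blocks (F x y) default

  Q+¬full*R≤P : ∀ x → Q x + 𝟙 (not (full x)) * R x ≤ P x
  Q+¬full*R≤P x with full x in eq
  ... | true  = subst (_≤ P x) (sym (+-identityʳ (Q x)))
                  (∑-mono blocks λ y _ → ≤-trans (proj₁ (ones-between x y)) (proj₂ (ones-between x y)))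
  ... | false = begin
    Q x + 1 * R x                                         ≡⟨ cong (_+_ (Q x)) (*-identityˡ (R x)) ⟩
    Q x + R x                                             ≡⟨ ∑-+ blocks _ _ ⟨
    ∑[ y ∈ blocks ] (N * 𝟙 (F x y (z₀ x y)) + ones x y)   ≤⟨ ∑-mono blocks pointwise ⟩
    P x                                                   ∎
    where
    open ≤-Reasoning
    pointwise : ∀ y → y ∈ blocks → N * 𝟙 (F x y (z₀ x y)) + ones x y ≤ N * 𝟙 (F x y (z₁ x y))
    pointwise y y∈blocks
      rewrite count<length⇒chooseFalse blocks (F x y) default (¬full⇒ones<N x eq y y∈blocks)
            | *-zeroʳ N = proj₂ (ones-between x y)

  balanced-S₃⇒42N²≤100R : ∀ x → 42 * M < hits (S₃ x) true * 100 → 42 * (N * N) ≤ 100 * R x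
  balanced-S₃⇒42N²≤100R x 42%<hits = <⇒≤ (*-cancelˡ-< N _ _ (subst₂ _<_ lhs rhs 42%<hits))
    where
    lhs : 42 * M ≡ N * (42 * (N * N))
    lhs = trans (cong (42 *_) M≡N³) (reassoc N)
      where reassoc : ∀ N → 42 * (N * (N * N)) ≡ N * (42 * (N * N))
            reassoc = solve-∀
    rhs : hits (S₃ x) true * 100 ≡ N * (100 * R x)
    rhs = trans (cong (_* 100) (hits-S₃ x)) (reassoc N (R x))
      where reassoc : ∀ N R → N * R * 100 ≡ N * (100 * R)
            reassoc = solve-∀

  #notFull #full R-notFull : ℕ
  #notFull  = ∑[ x ∈ blocks ] 𝟙 (not (full x))
  #full     = ∑[ x ∈ blocks ] 𝟙 (full x)
  R-notFull = ∑[ x ∈ blocks ] 𝟙 (not (full x)) * R x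

  ∑Q+R-notFull≤∑P : ∑ blocks Q + R-notFull ≤ ∑ blocks P
  ∑Q+R-notFull≤∑P =
    ≤-trans (≤-reflexive (sym (∑-+ blocks _ _))) (∑-mono blocks λ x _ → Q+¬full*R≤P x)

  N²#full≤hits-S₂ : N * (N * #full) ≤ hits S₂ true
  N²#full≤hits-S₂ = begin
    N * (N * #full)                          ≡⟨ cong (N *_) (∑-*ˡ blocks N _) ⟨
    N * (∑[ x ∈ blocks ] N * 𝟙 (full x))     ≡⟨ ∑-*ˡ blocks N _ ⟨
    ∑[ x ∈ blocks ] N * (N * 𝟙 (full x))     ≤⟨ ∑-mono blocks (λ x _ → *-monoʳ-≤ N (N*full≤ones x)) ⟩
    ∑[ x ∈ blocks ] N * ones x (yFull x)     ≡⟨ hits-S₂ ⟨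
    hits S₂ true                             ∎
    where open ≤-Reasoning

  #notFull+#full≡N : #notFull + #full ≡ N
  #notFull+#full≡N = begin
    #notFull + #full                                   ≡⟨ ∑-+ blocks _ _ ⟨
    ∑[ x ∈ blocks ] (𝟙 (not (full x)) + 𝟙 (full x))   ≡⟨ ∑-cong blocks (λ x → 𝟙-not′ (full x)) ⟩
    ∑[ x ∈ blocks ] 1                                  ≡⟨ ∑-const blocks 1 ⟩
    N * 1                                              ≡⟨ *-identityʳ N ⟩
    N                                                  ∎
    where
    open ≡-Reasoning
    𝟙-not′ : ∀ b → 𝟙 (not b) + 𝟙 b ≡ 1
    𝟙-not′ b = trans (+-comm (𝟙 (not b)) (𝟙 b)) (𝟙-not b)

  N²#notFull+N²#full≡M : N * (N * #notFull) + N * (N * #full) ≡ M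
  N²#notFull+N²#full≡M = begin
    N * (N * #notFull) + N * (N * #full)    ≡⟨ *-distribˡ-+ N (N * #notFull) (N * #full) ⟨
    N * (N * #notFull + N * #full)          ≡⟨ cong (N *_) (*-distribˡ-+ N #notFull #full) ⟨
    N * (N * (#notFull + #full))            ≡⟨ cong (λ t → N * (N * t)) #notFull+#full≡N ⟩
    N * (N * N)                             ≡⟨ M≡N³ ⟨
    M                                       ∎
    where open ≡-Reasoning

  42N²#notFull≤R-notFull*100 : (∀ x → x ∈ blocks → 42 * (N * N) ≤ 100 * R x) →
                               42 * (N * (N * #notFull)) ≤ R-notFull * 100
  42N²#notFull≤R-notFull*100 dense = begin
    42 * (N * (N * #notFull))                         ≡⟨ reassoc 42 N #notFull ⟩
    42 * (N * N) * #notFull                           ≡⟨ ∑-*ˡ blocks (42 * (N * N)) _ ⟨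
    ∑[ x ∈ blocks ] 42 * (N * N) * 𝟙 (not (full x))   ≤⟨ ∑-mono blocks pointwise ⟩
    ∑[ x ∈ blocks ] 100 * (𝟙 (not (full x)) * R x)   ≡⟨ ∑-*ˡ blocks 100 _ ⟩
    100 * R-notFull                                   ≡⟨ *-comm 100 R-notFull ⟩
    R-notFull * 100                                   ∎
    where
    open ≤-Reasoning
    reassoc : ∀ a N k → a * (N * (N * k)) ≡ a * (N * N) * k
    reassoc = solve-∀
    pointwise : ∀ x → x ∈ blocks → 42 * (N * N) * 𝟙 (not (full x)) ≤ 100 * (𝟙 (not (full x)) * R x)
    pointwise x x∈blocks with full x
    ... | true  = ≤-reflexive (*-zeroʳ (42 * (N * N)))
    ... | false = subst₂ _≤_ (sym (*-identityʳ _)) (cong (100 *_) (sym (*-identityˡ (R x))))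
                         (dense x x∈blocks)

  balanced : ∀ S → ¬ Far M (hits S true) → 42 * M < hits S true * 100 × hits S true * 100 < 58 * M
  balanced S = ¬far⇒balanced M (hits S true)

  not-all-balanced : ¬ Far M (hits S₁ true) → ¬ Far M (hits S₀ true) → ¬ Far M (hits S₂ true) →
                     (∀ c → c ∈ blocks → ¬ Far M (hits (S₃ c) true)) → ⊥
  not-all-balanced ¬far₁ ¬far₀ ¬far₂ ¬far₃ =
    balanced-counts-inconsistent M (∑ blocks P) (∑ blocks Q) R-notFull (N * (N * #notFull)) (N * (N * #full))
      (subst (λ h → h * 100 < 58 * M) hits-S₁ (proj₂ (balanced S₁ ¬far₁)))
      (subst (λ h → 42 * M < h * 100) hits-S₀ (proj₁ (balanced S₀ ¬far₀)))
      ∑Q+R-notFull≤∑P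
      (≤-<-trans (*-monoˡ-≤ 100 N²#full≤hits-S₂) (proj₂ (balanced S₂ ¬far₂)))
      N²#notFull+N²#full≡M
      (42N²#notFull≤R-notFull*100 λ x x∈blocks →
        balanced-S₃⇒42N²≤100R x (proj₁ (balanced (S₃ x) (¬far₃ x x∈blocks))))

  far-source : Σ (Spec n 3) λ S → IsUniformSHELA 2 S × Far M (hits S true)
  far-source with far? M (hits S₁ true) | far? M (hits S₀ true) | far? M (hits S₂ true)
                | any? (λ c → far? M (hits (S₃ c) true)) blocks
  ... | yes far₁ | _        | _        | _        = S₁ , ≤-refl , far₁
  ... | no  _    | yes far₀ | _        | _        = S₀ , ≤-refl , far₀
  ... | no  _    | no  _    | yes far₂ | _        = S₂ , ≤-refl , far₂
  ... | no  _    | no  _    | no  _    | yes any₃ =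
    let c , far₃ = satisfied any₃ in S₃ c , ≤-refl , far₃
  ... | no ¬far₁ | no ¬far₀ | no ¬far₂ | no ¬any₃ =
    ⊥-elim (not-all-balanced ¬far₁ ¬far₀ ¬far₂ λ c c∈blocks far₃ → ¬any₃ (lose c∈blocks far₃))

mainTheorem10 : (n : ℕ) → 1 ≤ n → (f : Vec (Block n) 3 → Bool) →
    Σ (Spec n 3) (λ S → IsUniformSHELA 2 S × ((+ 8) / 100 ≤ℚ SD (prob f S) U₁))
mainTheorem10 n _ f =
  let open Construction n f
      S , uniform , far = far-source
  in  S , uniform , far⇒8%≤SD {{m^n≢0 2 (n * 3)}} (hits S) (hits-false+true S) far
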